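{- Let $\pi\in S_n$ be such that $G_\pi$ is connected with domination number $k$, let $D$ be a minimum dominating set of $G_\pi$, and let $a\in D$ be the element of $D$ appearing rightmost in the one-line notation of $\pi$. Let $\tau\in S_{n+1}$ be the permutation obtained by inserting $n+1$ immediately to the left of $a$ in the one-line notation of $\pi$. Then $G_\tau$ is a connected permutation graph on $n+1$ vertices with domination number $k$.
   Context: For a permutation $\pi$ of $[n]=\{1,\dots,n\}$ (one-line notation $[\pi(1),\dots,\pi(n)]$), the permutation graph $G_\pi$ has vertex set $[n]$ and an edge between $i<j$ iff $\pi^{ -1}(i)>\pi^{ -1}(j)$. A dominating set is a set $D$ of vertices such that every vertex is in $D$ or adjacent to a vertex of $D$; the domination number is the minimum size of a dominating set, and a minimum dominating set is one of that size. -}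

module Defs where

open import Data.Nat using (ℕ; suc; _≤_)
open import Data.Fin using (Fin; _<_; inject₁; fromℕ) renaming (_≤_ to _≤ᶠ_)
open import Data.Fin.Subset using (Subset; _∈_; ∣_∣)
open import Data.Fin.Permutation using (Permutation′; _⟨$⟩ʳ_; _⟨$⟩ˡ_)
open import Data.Vec using (Vec; tabulate; insertAt; map)
open import Data.Product using (Σ; _×_; ∃)
open import Data.Sum using (_⊎_)

-- Conventions: vertices and positions are Fin n (0-indexed).
-- π ⟨$⟩ʳ p is the entry at position p of the one-line notation, so
-- π ⟨$⟩ˡ v = π⁻¹(v) is the position of value v.

pos : ∀ {n} → Permutation′ n → Fin n → Fin n
pos π v = π ⟨$⟩ˡ v

oneLine : ∀ {n} → Permutation′ n → Vec (Fin n) n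
oneLine π = tabulate (λ p → π ⟨$⟩ʳ p)

Adj : ∀ {n} → Permutation′ n → Fin n → Fin n → Set
Adj π i j = (i < j × pos π j < pos π i) ⊎ (j < i × pos π i < pos π j)

data Reachable {n} (π : Permutation′ n) : Fin n → Fin n → Set where
  here : ∀ {u} → Reachable π u u
  step : ∀ {u v w} → Adj π u v → Reachable π v w → Reachable π u w

Connected : ∀ {n} → Permutation′ n → Set
Connected {n} π = ∀ (u v : Fin n) → Reachable π u v

Dominating : ∀ {n} → Permutation′ n → Subset n → Set
Dominating {n} π D = ∀ (v : Fin n) → v ∈ D ⊎ Σ (Fin n) (λ u → u ∈ D × Adj π u v)

MinDominating : ∀ {n} → Permutation′ n → Subset n → Set
MinDominating {n} π D = Dominating π D × (∀ (D′ : Subset n) → Dominating π D′ → ∣ D ∣ ≤ ∣ D′ ∣)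

DomNumber : ∀ {n} → Permutation′ n → ℕ → Set
DomNumber {n} π k =
  Σ (Subset n) (λ D → Dominating π D × ∣ D ∣ ≡ k) × (∀ (D : Subset n) → Dominating π D → k ≤ ∣ D ∣)
  where open import Relation.Binary.PropositionalEquality using (_≡_)

RightmostIn : ∀ {n} → Permutation′ n → Subset n → Fin n → Set
RightmostIn {n} π D a = a ∈ D × (∀ (b : Fin n) → b ∈ D → pos π b ≤ᶠ pos π a)

insertLeftOf : ∀ {n} → Permutation′ n → Fin n → Vec (Fin (suc n)) (suc n)
insertLeftOf {n} π a = insertAt (map inject₁ (oneLine π)) (inject₁ (pos π a)) (fromℕ n)

module Submission where

-- Write p₀ for the position of a in π.  In τ the old values keep their relative order
-- (value v moves to position punchIn p₀ (pos π v)), so G_π is the induced subgraph of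
-- G_τ on the old vertices, and the new vertex n+1, being larger than everything and sitting
-- at position p₀, is adjacent exactly to the old vertices at positions ≥ p₀ (Insertion).
--   * Connectivity: n+1 is adjacent to a, and old walks remain walks.
--   * γ(τ) ≤ k: a minimum dominating set D of G_π contains a, which dominates n+1.
--   * γ(τ) ≥ k: a dominating set D′ of G_τ avoiding n+1 restricts to one of G_π.
--     Otherwise n+1 can be traded for the greatest element M of D: since every element
--     of D lies at or left of a, M dominates every vertex at or right of a (suffix-dominator),
--     which is all that n+1 dominated among the old vertices.

open import Defs
open import Data.Nat using (ℕ; zero; suc; z≤n; s≤s)
import Data.Nat as ℕ
import Data.Nat.Properties as ℕP
open import Data.Fin using (Fin; inject₁; fromℕ; punchIn) renaming (zero to fzero; suc to fsuc)
import Data.Fin as F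
import Data.Fin.Properties as FP
open import Data.Fin.Relation.Unary.Top using (view; ‵fromℕ; ‵inject₁)
open import Data.Fin.Subset using (Subset; _∈_; _∉_; ∣_∣; inside; outside; Nonempty)
open import Data.Fin.Subset.Properties using (_∈?_; nonempty?)
open import Data.Fin.Permutation using (Permutation′; _⟨$⟩ʳ_; _⟨$⟩ˡ_; inverseˡ; inverseʳ)
open import Data.Vec using ([]; _∷_; lookup; map)
open import Data.Vec.Base using (here; there)
open import Data.Vec.Properties using (lookup∘tabulate; insertAt-lookup; insertAt-punchIn; lookup-map)
open import Data.Product using (_×_; _,_; Σ; proj₁)
open import Data.Sum using (_⊎_; inj₁; inj₂)
open import Data.Empty using (⊥-elim)
open import Relation.Nullary using (yes; no)
open import Relation.Binary.PropositionalEquality using (_≡_; refl; sym; trans; cong; subst₂; module ≡-Reasoning)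

Adj-sym : ∀ {n} {π : Permutation′ n} {u v} → Adj π u v → Adj π v u
Adj-sym (inj₁ h) = inj₂ h
Adj-sym (inj₂ h) = inj₁ h

Reachable-trans : ∀ {n} {π : Permutation′ n} {u v w} →
                  Reachable π u v → Reachable π v w → Reachable π u w
Reachable-trans here       q = q
Reachable-trans (step e p) q = step e (Reachable-trans p q)

pos-injective : ∀ {n} (π : Permutation′ n) {u v} → pos π u ≡ pos π v → u ≡ v
pos-injective π {u} {v} eq = begin
  u                   ≡⟨ sym (inverseʳ π) ⟩
  π ⟨$⟩ʳ (π ⟨$⟩ˡ u)   ≡⟨ cong (π ⟨$⟩ʳ_) eq ⟩
  π ⟨$⟩ʳ (π ⟨$⟩ˡ v)   ≡⟨ inverseʳ π ⟩
  v                   ∎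
  where open ≡-Reasoning

greatest : ∀ {n} (p : Subset n) → Nonempty p →
           Σ (Fin n) λ m → m ∈ p × (∀ {y} → y ∈ p → y F.≤ m)
greatest {suc k} (s ∷ p) nonempty with nonempty? p
... | no p-empty = fzero , zero∈ nonempty , bound
  where
  zero∈ : Nonempty (s ∷ p) → fzero ∈ s ∷ p
  zero∈ (fzero  , h)        = h
  zero∈ (fsuc y , there y∈) = ⊥-elim (p-empty (y , y∈))
  bound : ∀ {y} → y ∈ s ∷ p → y F.≤ fzero {k}
  bound here       = z≤n
  bound (there y∈) = ⊥-elim (p-empty (_ , y∈))
... | yes p-nonempty with greatest p p-nonempty
...   | m , m∈p , m-max = fsuc m , there m∈p , bound
  where
  bound : ∀ {y} → y ∈ s ∷ p → y F.≤ fsuc m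
  bound here       = z≤n
  bound (there y∈) = s≤s (m-max y∈)

widen : ∀ {n} → Subset n → Subset (suc n)
widen []      = outside ∷ []
widen (s ∷ p) = s ∷ widen p

∈-widen : ∀ {n} {p : Subset n} {v} → v ∈ p → inject₁ v ∈ widen p
∈-widen here       = here
∈-widen (there v∈) = there (∈-widen v∈)

∣widen∣ : ∀ {n} (p : Subset n) → ∣ widen p ∣ ≡ ∣ p ∣
∣widen∣ []            = refl
∣widen∣ (inside ∷ p)  = cong suc (∣widen∣ p)
∣widen∣ (outside ∷ p) = ∣widen∣ p

narrow : ∀ {n} → Subset (suc n) → Subset n
narrow {zero}  (_ ∷ []) = []
narrow {suc n} (s ∷ p)  = s ∷ narrow p

∈-narrow : ∀ {n} {p : Subset (suc n)} {v : Fin n} → inject₁ v ∈ p → v ∈ narrow p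
∈-narrow {suc n} {v = fzero}  here       = here
∈-narrow {suc n} {v = fsuc v} (there v∈) = there (∈-narrow v∈)

∣narrow∣≤ : ∀ {n} (p : Subset (suc n)) → ∣ narrow p ∣ ℕ.≤ ∣ p ∣
∣narrow∣≤ {zero}  (_ ∷ [])      = z≤n
∣narrow∣≤ {suc n} (inside ∷ p)  = s≤s (∣narrow∣≤ p)
∣narrow∣≤ {suc n} (outside ∷ p) = ∣narrow∣≤ p

∣narrow∣< : ∀ {n} (p : Subset (suc n)) → fromℕ n ∈ p → ∣ narrow p ∣ ℕ.< ∣ p ∣
∣narrow∣< {zero}  (inside ∷ [])  here       = s≤s z≤n
∣narrow∣< {suc n} (inside ∷ p)  (there t∈) = s≤s (∣narrow∣< p t∈)
∣narrow∣< {suc n} (outside ∷ p) (there t∈) = ∣narrow∣< p t∈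

add : ∀ {n} → Subset n → Fin n → Subset n
add (_ ∷ p) fzero    = inside ∷ p
add (s ∷ p) (fsuc x) = s ∷ add p x

∈-add-new : ∀ {n} (p : Subset n) (x : Fin n) → x ∈ add p x
∈-add-new (_ ∷ p) fzero    = here
∈-add-new (_ ∷ p) (fsuc x) = there (∈-add-new p x)

∈-add-old : ∀ {n} (p : Subset n) (x : Fin n) {v} → v ∈ p → v ∈ add p x
∈-add-old (_ ∷ p) fzero    here       = here
∈-add-old (_ ∷ p) fzero    (there v∈) = there v∈
∈-add-old (_ ∷ p) (fsuc x) here       = here
∈-add-old (_ ∷ p) (fsuc x) (there v∈) = there (∈-add-old p x v∈)

∣add∣≤ : ∀ {n} (p : Subset n) (x : Fin n) → ∣ add p x ∣ ℕ.≤ suc ∣ p ∣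
∣add∣≤ (inside ∷ p)  fzero    = ℕP.n≤1+n _
∣add∣≤ (outside ∷ p) fzero    = ℕP.≤-refl
∣add∣≤ (inside ∷ p)  (fsuc x) = s≤s (∣add∣≤ p x)
∣add∣≤ (outside ∷ p) (fsuc x) = ∣add∣≤ p x

inject₁-< : ∀ {n} {u v : Fin n} → u F.< v → inject₁ u F.< inject₁ v
inject₁-< {u = u} {v} = subst₂ ℕ._<_ (sym (FP.toℕ-inject₁ u)) (sym (FP.toℕ-inject₁ v))

inject₁-<⁻ : ∀ {n} {u v : Fin n} → inject₁ u F.< inject₁ v → u F.< v
inject₁-<⁻ {u = u} {v} = subst₂ ℕ._<_ (FP.toℕ-inject₁ u) (FP.toℕ-inject₁ v)

inject₁<fromℕ : ∀ {n} (v : Fin n) → inject₁ v F.< fromℕ n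
inject₁<fromℕ {n} v = subst₂ ℕ._<_ (sym (FP.toℕ-inject₁ v)) (sym (FP.toℕ-fromℕ n)) (FP.toℕ<n v)

punchIn-< : ∀ {n} (i : Fin (suc n)) {j k : Fin n} → j F.< k → punchIn i j F.< punchIn i k
punchIn-< i {j} {k} j<k = ℕP.≰⇒> (λ h → ℕP.<⇒≱ j<k (FP.punchIn-cancel-≤ i k j h))

punchIn-<⁻ : ∀ {n} (i : Fin (suc n)) {j k : Fin n} → punchIn i j F.< punchIn i k → j F.< k
punchIn-<⁻ i {j} {k} h = ℕP.≰⇒> (λ h′ → ℕP.<⇒≱ h (FP.punchIn-mono-≤ i k j h′))

gap-left : ∀ {n} (q j : Fin n) → q F.≤ j → inject₁ q F.< punchIn (inject₁ q) j
gap-left fzero    j        _         = s≤s z≤n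
gap-left (fsuc q) (fsuc j) (s≤s q≤j) = s≤s (gap-left q j q≤j)

gap-left⁻ : ∀ {n} (q j : Fin n) → inject₁ q F.< punchIn (inject₁ q) j → q F.≤ j
gap-left⁻ fzero    j        _       = z≤n
gap-left⁻ (fsuc q) (fsuc j) (s≤s h) = s≤s (gap-left⁻ q j h)

-- If all elements of a dominating set D lie at or left of a, then the greatest element M
-- of D dominates every vertex at or right of a: a dominator d of such a vertex v lies
-- left of v, hence d > v, so v ≤ M, while M itself lies at or left of a.
suffix-dominator : ∀ {n} (π : Permutation′ n) {D : Subset n} {a : Fin n} →
                   Dominating π D → RightmostIn π D a →
                   Σ (Fin n) λ M → ∀ v → pos π a F.≤ pos π v → v ≡ M ⊎ Adj π M v
suffix-dominator π {D} {a} D-dom (a∈D , D-left) with greatest D (a , a∈D)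
... | M , M∈D , M-max = M , dominated
  where
  below-M : ∀ v → pos π a F.≤ pos π v → v F.≤ M
  below-M v a≤v with D-dom v
  ... | inj₁ v∈D = M-max v∈D
  ... | inj₂ (d , d∈D , inj₁ (_ , v<ᵖd)) =
    ⊥-elim (ℕP.<⇒≱ v<ᵖd (ℕP.≤-trans (D-left d d∈D) a≤v))
  ... | inj₂ (d , d∈D , inj₂ (v<d , _)) = ℕP.<⇒≤ (ℕP.<-≤-trans v<d (M-max d∈D))

  dominated : ∀ v → pos π a F.≤ pos π v → v ≡ M ⊎ Adj π M v
  dominated v a≤v with v FP.≟ M
  ... | yes v≡M = inj₁ v≡M
  ... | no v≢M = inj₂ (inj₂ (FP.≤∧≢⇒< (below-M v a≤v) v≢M ,
                             FP.≤∧≢⇒< (ℕP.≤-trans (D-left M M∈D) a≤v)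
                                      (λ eq → v≢M (sym (pos-injective π eq)))))

module Insertion {n} (π : Permutation′ n) (a : Fin n)
                 (τ : Permutation′ (suc n)) (τ≡ : oneLine τ ≡ insertLeftOf π a) where

  top : Fin (suc n)
  top = fromℕ n

  gap : Fin (suc n)
  gap = inject₁ (pos π a)

  entry : ∀ q → τ ⟨$⟩ʳ q ≡ lookup (insertLeftOf π a) q
  entry q = begin
    τ ⟨$⟩ʳ q                       ≡⟨ sym (lookup∘tabulate (τ ⟨$⟩ʳ_) q) ⟩
    lookup (oneLine τ) q           ≡⟨ cong (λ xs → lookup xs q) τ≡ ⟩
    lookup (insertLeftOf π a) q    ∎
    where open ≡-Reasoning

  pos-top : pos τ top ≡ gap
  pos-top = begin
    τ ⟨$⟩ˡ top               ≡⟨ cong (τ ⟨$⟩ˡ_) (sym entry-gap) ⟩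
    τ ⟨$⟩ˡ (τ ⟨$⟩ʳ gap)      ≡⟨ inverseˡ τ ⟩
    gap                      ∎
    where
    open ≡-Reasoning
    entry-gap : τ ⟨$⟩ʳ gap ≡ top
    entry-gap = trans (entry gap)
                  (insertAt-lookup (map inject₁ (oneLine π)) gap top)

  pos-old : ∀ v → pos τ (inject₁ v) ≡ punchIn gap (pos π v)
  pos-old v = begin
    τ ⟨$⟩ˡ inject₁ v                        ≡⟨ cong (λ w → τ ⟨$⟩ˡ inject₁ w) (sym (inverseʳ π)) ⟩
    τ ⟨$⟩ˡ inject₁ (π ⟨$⟩ʳ p)               ≡⟨ cong (τ ⟨$⟩ˡ_) (sym entry-old) ⟩
    τ ⟨$⟩ˡ (τ ⟨$⟩ʳ punchIn gap p)           ≡⟨ inverseˡ τ ⟩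
    punchIn gap p                            ∎
    where
    open ≡-Reasoning
    p = pos π v
    entry-old : τ ⟨$⟩ʳ punchIn gap p ≡ inject₁ (π ⟨$⟩ʳ p)
    entry-old = begin
      τ ⟨$⟩ʳ punchIn gap p                                               ≡⟨ entry _ ⟩
      lookup (insertLeftOf π a) (punchIn gap p)                          ≡⟨ insertAt-punchIn _ gap top p ⟩
      lookup (map inject₁ (oneLine π)) p                                 ≡⟨ lookup-map p inject₁ (oneLine π) ⟩
      inject₁ (lookup (oneLine π) p)                                     ≡⟨ cong inject₁ (lookup∘tabulate (π ⟨$⟩ʳ_) p) ⟩
      inject₁ (π ⟨$⟩ʳ p)                                                 ∎

  pos-old-< : ∀ {u v} → pos π u F.< pos π v → pos τ (inject₁ u) F.< pos τ (inject₁ v)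
  pos-old-< {u} {v} h = subst₂ F._<_ (sym (pos-old u)) (sym (pos-old v)) (punchIn-< gap h)

  pos-old-<⁻ : ∀ {u v} → pos τ (inject₁ u) F.< pos τ (inject₁ v) → pos π u F.< pos π v
  pos-old-<⁻ {u} {v} h = punchIn-<⁻ gap (subst₂ F._<_ (pos-old u) (pos-old v) h)

  adj-old : ∀ {u v} → Adj π u v → Adj τ (inject₁ u) (inject₁ v)
  adj-old (inj₁ (u<v , h)) = inj₁ (inject₁-< u<v , pos-old-< h)
  adj-old (inj₂ (v<u , h)) = inj₂ (inject₁-< v<u , pos-old-< h)

  adj-old⁻ : ∀ {u v} → Adj τ (inject₁ u) (inject₁ v) → Adj π u v
  adj-old⁻ (inj₁ (u<v , h)) = inj₁ (inject₁-<⁻ u<v , pos-old-<⁻ h)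
  adj-old⁻ (inj₂ (v<u , h)) = inj₂ (inject₁-<⁻ v<u , pos-old-<⁻ h)

  adj-top : ∀ v → pos π a F.≤ pos π v → Adj τ top (inject₁ v)
  adj-top v a≤v = inj₂ (inject₁<fromℕ v ,
    subst₂ F._<_ (sym pos-top) (sym (pos-old v)) (gap-left (pos π a) (pos π v) a≤v))

  adj-top⁻ : ∀ v → Adj τ top (inject₁ v) → pos π a F.≤ pos π v
  adj-top⁻ v (inj₁ (top<v , _)) = ⊥-elim (ℕP.<-asym top<v (inject₁<fromℕ v))
  adj-top⁻ v (inj₂ (_ , h)) =
    gap-left⁻ (pos π a) (pos π v) (subst₂ F._<_ pos-top (pos-old v) h)

  reach-old : ∀ {u v} → Reachable π u v → Reachable τ (inject₁ u) (inject₁ v)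
  reach-old here       = here
  reach-old (step e r) = step (adj-old e) (reach-old r)

  connected : Connected π → Connected τ
  connected conn u v with view u | view v
  ... | ‵fromℕ      | ‵fromℕ      = here
  ... | ‵fromℕ      | ‵inject₁ v′ = step (adj-top a FP.≤-refl) (reach-old (conn a v′))
  ... | ‵inject₁ u′ | ‵fromℕ      =
    Reachable-trans (reach-old (conn u′ a)) (step (Adj-sym {π = τ} (adj-top a FP.≤-refl)) here)
  ... | ‵inject₁ u′ | ‵inject₁ v′ = reach-old (conn u′ v′)

  widen-dominates : ∀ {D} → Dominating π D → a ∈ D → Dominating τ (widen D)
  widen-dominates D-dom a∈D w with view w
  ... | ‵fromℕ = inj₂ (inject₁ a , ∈-widen a∈D , Adj-sym {π = τ} (adj-top a FP.≤-refl))
  ... | ‵inject₁ v with D-dom v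
  ...   | inj₁ v∈D             = inj₁ (∈-widen v∈D)
  ...   | inj₂ (u , u∈D , u~v) = inj₂ (inject₁ u , ∈-widen u∈D , adj-old u~v)

  narrow-dominates : ∀ {D′} → Dominating τ D′ → top ∉ D′ → Dominating π (narrow D′)
  narrow-dominates D′-dom top∉ v with D′-dom (inject₁ v)
  ... | inj₁ v∈ = inj₁ (∈-narrow v∈)
  ... | inj₂ (w , w∈ , w~v) with view w
  ...   | ‵fromℕ     = ⊥-elim (top∉ w∈)
  ...   | ‵inject₁ u = inj₂ (u , ∈-narrow w∈ , adj-old⁻ w~v)

  trade-top-dominates : ∀ {D′} → Dominating τ D′ → (M : Fin n) →
                        (∀ v → pos π a F.≤ pos π v → v ≡ M ⊎ Adj π M v) →
                        Dominating π (add (narrow D′) M)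
  trade-top-dominates D′-dom M M-dom v with D′-dom (inject₁ v)
  ... | inj₁ v∈ = inj₁ (∈-add-old _ M (∈-narrow v∈))
  ... | inj₂ (w , w∈ , w~v) with view w
  ...   | ‵inject₁ u = inj₂ (u , ∈-add-old _ M (∈-narrow w∈) , adj-old⁻ w~v)
  ...   | ‵fromℕ with M-dom v (adj-top⁻ v w~v)
  ...     | inj₁ refl = inj₁ (∈-add-new _ M)
  ...     | inj₂ M~v  = inj₂ (M , ∈-add-new _ M , M~v)

  shrink : ∀ {D} → Dominating π D → RightmostIn π D a →
           ∀ D′ → Dominating τ D′ → Σ (Subset n) λ E → Dominating π E × ∣ E ∣ ℕ.≤ ∣ D′ ∣
  shrink D-dom a-right D′ D′-dom with top ∈? D′
  ... | no top∉ = narrow D′ , narrow-dominates D′-dom top∉ , ∣narrow∣≤ D′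
  ... | yes top∈ =
    let (M , M-dom) = suffix-dominator π D-dom a-right
    in add (narrow D′) M , trade-top-dominates D′-dom M M-dom ,
       ℕP.≤-trans (∣add∣≤ (narrow D′) M) (∣narrow∣< D′ top∈)

theorem8 : (n k : ℕ) (π : Permutation′ n) (D : Subset n) (a : Fin n)
    → Connected π → DomNumber π k → MinDominating π D → RightmostIn π D a
    → (τ : Permutation′ (suc n)) → oneLine τ ≡ insertLeftOf π a
    → Connected τ × DomNumber τ k
theorem8 n k π D a conn ((D₀ , D₀-dom , ∣D₀∣≡k) , k-min) (D-dom , D-min) a-right τ τ≡ =
  connected conn , (widen D , widen-dominates D-dom (proj₁ a-right) , ∣widen-D∣≡k) , k-lower
  where
  open Insertion π a τ τ≡

  -- ∣D∣ = k: D is minimum and D₀ has size k, while k bounds every dominating set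
  ∣widen-D∣≡k : ∣ widen D ∣ ≡ k
  ∣widen-D∣≡k = trans (∣widen∣ D)
    (ℕP.≤-antisym (ℕP.≤-trans (D-min D₀ D₀-dom) (ℕP.≤-reflexive ∣D₀∣≡k)) (k-min D D-dom))

  k-lower : ∀ D′ → Dominating τ D′ → k ℕ.≤ ∣ D′ ∣
  k-lower D′ D′-dom =
    let (E , E-dom , ∣E∣≤∣D′∣) = shrink D-dom a-right D′ D′-dom
    in ℕP.≤-trans (k-min E E-dom) ∣E∣≤∣D′∣
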